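{- For every pair of integers $r,s$ with $r\ge 3$ and $\frac{3r}{2}+1\le s\le 2^r-1$, there exists a connected bipartite graph $G$ with stable sets $U,W$ of sizes $|U|=r$ and $|W|=s$ such that $\lambda(\overline{G})=\lambda(G)+1$.
   Context: A set $S$ of vertices is distinguishing if $N(x)\cap S\neq N(y)\cap S$ for all distinct vertices $x,y\notin S$ ($N$ = open neighborhood); a locating-dominating set is a distinguishing set $S$ such that every vertex not in $S$ has a neighbor in $S$. $\lambda(G)$ is the minimum cardinality of a locating-dominating set of $G$, and $\overline{G}$ is the complement of $G$. -}

module Defs where

open import Data.Nat using (ℕ; _≤_)
open import Data.Bool using (Bool; true; false; not; _∧_)
open import Data.Bool.Properties using (∧-comm; ∧-zeroʳ)
open import Data.Fin using (Fin; _≟_)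
open import Data.Fin.Subset using (Subset; _∈_; _∉_; _∩_; ∣_∣)
open import Data.Vec using (tabulate)
open import Data.Product using (Σ; ∃; _×_; _,_)
open import Data.Sum using (_⊎_)
open import Relation.Nullary using (¬_; does; yes; no)
open import Relation.Binary.PropositionalEquality using (_≡_; _≢_; refl; cong₂; sym)

record Graph (n : ℕ) : Set where
  field
    adj    : Fin n → Fin n → Bool
    adj-sym    : ∀ x y → adj x y ≡ adj y x
    adj-irrefl : ∀ x → adj x x ≡ false
open Graph public

Adj : ∀ {n} → Graph n → Fin n → Fin n → Set
Adj G x y = adj G x y ≡ true

N : ∀ {n} → Graph n → Fin n → Subset n
N G x = tabulate (adj G x)

private
  neq : ∀ {n} → Fin n → Fin n → Bool
  neq x y = not (does (x ≟ y))

  neq-sym : ∀ {n} (x y : Fin n) → neq x y ≡ neq y x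
  neq-sym x y with x ≟ y | y ≟ x
  ... | yes _ | yes _ = refl
  ... | no _  | no _  = refl
  ... | yes p | no q  = Data.Empty.⊥-elim (q (sym p)) where import Data.Empty
  ... | no p  | yes q = Data.Empty.⊥-elim (p (sym q)) where import Data.Empty

  neq-irr : ∀ {n} (x : Fin n) → neq x x ≡ false
  neq-irr x with x ≟ x
  ... | yes _ = refl
  ... | no p  = Data.Empty.⊥-elim (p refl) where import Data.Empty

complement : ∀ {n} → Graph n → Graph n
adj (complement G) x y = not (adj G x y) ∧ neq x y
adj-sym (complement G) x y = cong₂ (λ a b → not a ∧ b) (adj-sym G x y) (neq-sym x y)
adj-irrefl (complement G) x rewrite neq-irr x = ∧-zeroʳ (not (adj G x x))

Distinguishing : ∀ {n} → Graph n → Subset n → Set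
Distinguishing G S = ∀ x y → x ∉ S → y ∉ S → x ≢ y → (N G x ∩ S) ≢ (N G y ∩ S)

Dominating : ∀ {n} → Graph n → Subset n → Set
Dominating G S = ∀ x → x ∉ S → ∃ λ y → y ∈ S × Adj G x y

LocatingDominating : ∀ {n} → Graph n → Subset n → Set
LocatingDominating G S = Distinguishing G S × Dominating G S

IsLambda : ∀ {n} → Graph n → ℕ → Set
IsLambda G k = (∃ λ S → LocatingDominating G S × ∣ S ∣ ≡ k)
             × (∀ S → LocatingDominating G S → k ≤ ∣ S ∣)

data Reach {n} (G : Graph n) : Fin n → Fin n → Set where
  here : ∀ {x} → Reach G x x
  step : ∀ {x y z} → Adj G x y → Reach G y z → Reach G x z

Connected : ∀ {n} → Graph n → Set
Connected G = ∀ x y → Reach G x y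

Stable : ∀ {n} → Graph n → Subset n → Set
Stable G U = ∀ x y → x ∈ U → y ∈ U → ¬ Adj G x y

BipartiteWithParts : ∀ {n} → Graph n → ℕ → ℕ → Set
BipartiteWithParts {n} G r s =
  Σ (Subset n) λ U → Σ (Subset n) λ W →
    (∀ x → x ∈ U ⊎ x ∈ W) × (∀ x → x ∈ U → x ∉ W) ×
    Stable G U × Stable G W × ∣ U ∣ ≡ r × ∣ W ∣ ≡ s

-- Label the s vertices of W injectively by proper subsets T w of U = {1, …, r}, one of them ∅,
-- and join u to w exactly when u ∉ T w; in the complement H, W is a clique and u ∼ w iff u ∈ T w.
-- Then U is locating-dominating in G, and U together with the vertex labelled ∅ is so in H.
-- Conversely, a distinguishing set S of G or H contains, for any two vertices of W outside S, a
-- vertex of U at which their labels differ. Group U into pairs {a, b}, plus one triple {a, b, c}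
-- when r is odd, and use the labels {a}, {b}, {a, b} (for the triple also {c} and {a, c}): if S
-- contains y vertices of a block, at most 2 ^ y vertices with the block's labels lie outside S,
-- which forces |S| ≥ r. In H, either S contains the vertex labelled ∅, or it misses a vertex of
-- U and ∅ enters the count of that block, or it contains U and, to dominate the vertex labelled ∅,
-- a vertex of W; so |S| ≥ r + 1. The bounds on s leave room for the 1 + ⌊(3r + 1)/2⌋ labels
-- needed among the 2 ^ r − 1 proper subsets.

module Submission where

open import Defs
open import Data.Nat using (ℕ; zero; suc; _+_; _*_; _^_; _≤_; _<_; _∸_; z≤n; s≤s; s≤s⁻¹)
open import Data.Nat.Properties
open import Data.Nat.ListAction using (sum)
open import Data.Bool using (Bool; true; false; not; _∧_)
open import Data.Fin as F using (Fin; zero; suc; _↑ˡ_; _↑ʳ_; splitAt)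
import Data.Fin.Properties as FP
open import Data.Fin.Subset using (Subset; _∈_; _∉_; _-_; _∩_; ∣_∣; ⊤; ⊥; ⁅_⁆; inside; outside; Nonempty)
import Data.Fin.Subset.Properties as SP
import Data.Vec.Properties as VP
import Data.Bool.Properties as BP
open import Data.Vec using (Vec; []; _∷_; lookup; tabulate; here; there) renaming (_++_ to _++ᵛ_)
open import Data.List as L using (List; []; _∷_; _++_; length; filter; map; concatMap)
import Data.List.Properties as LP
open import Data.List.Relation.Unary.All as All using (All; []; _∷_)
open import Data.List.Relation.Unary.Any as Any using (Any; here; there)
open import Data.List.Relation.Unary.AllPairs as AllPairs using (AllPairs; []; _∷_)
import Data.List.Relation.Unary.AllPairs.Properties as AllPairsP
import Data.List.Relation.Unary.All.Properties as AllP
open import Data.List.Relation.Unary.Unique.Propositional using (Unique)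
import Data.List.Relation.Unary.Unique.Propositional.Properties as UP
open import Data.List.Membership.Propositional using (find; lose) renaming (_∈_ to _∈ₗ_; _∉_ to _∉ₗ_)
import Data.List.Membership.Propositional.Properties as MP
open import Data.List.Relation.Binary.Disjoint.Propositional using (Disjoint)
open import Data.List.Relation.Unary.Any.Properties as AnyP using (lookup-index)
open import Data.Product using (Σ; ∃; _×_; _,_; proj₁; proj₂)
open import Data.Sum using (_⊎_; inj₁; inj₂)
open import Data.Empty using (⊥-elim)
open import Function using (_∘_; case_of_)
open import Relation.Nullary using (¬_; yes; no; ¬?; does; _×-dec_)
open import Relation.Nullary.Decidable using (decidable-stable)
open import Relation.Unary using (Decidable)
open import Relation.Binary.PropositionalEquality

private
  variable
    A B : Set

length-filter+length-filter-¬ : ∀ {P : A → Set} (P? : Decidable P) xs →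
  length (filter P? xs) + length (filter (¬? ∘ P?) xs) ≡ length xs
length-filter+length-filter-¬ P? [] = refl
length-filter+length-filter-¬ P? (x ∷ xs) with P? x
... | yes _ = cong suc (length-filter+length-filter-¬ P? xs)
... | no _  = trans (+-suc _ _) (cong suc (length-filter+length-filter-¬ P? xs))

length-concatMap : (f : A → List B) (xs : List A) →
  length (concatMap f xs) ≡ sum (map (length ∘ f) xs)
length-concatMap f [] = refl
length-concatMap f (x ∷ xs) = trans (LP.length-++ (f x)) (cong (length (f x) +_) (length-concatMap f xs))

∈-concatMap⁺ : ∀ (f : A → List B) {x xs v} → x ∈ₗ xs → v ∈ₗ f x → v ∈ₗ concatMap f xs
∈-concatMap⁺ f x∈ v∈ = MP.∈-concat⁺′ v∈ (MP.∈-map⁺ f x∈)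

∈-concatMap⁻ : ∀ (f : A → List B) {xs v} → v ∈ₗ concatMap f xs → ∃ λ x → x ∈ₗ xs × v ∈ₗ f x
∈-concatMap⁻ f {xs} v∈ with MP.∈-concat⁻′ (map f xs) v∈
... | _ , v∈ys , ys∈ with MP.∈-map⁻ f ys∈
...   | x , x∈ , refl = x , x∈ , v∈ys

sum-map-mono-≤ : ∀ {f g : A → ℕ} {xs} → All (λ x → f x ≤ g x) xs → sum (map f xs) ≤ sum (map g xs)
sum-map-mono-≤ [] = z≤n
sum-map-mono-≤ (p ∷ ps) = +-mono-≤ p (sum-map-mono-≤ ps)

sum-map-mono-< : ∀ {f g : A → ℕ} {xs} → All (λ x → f x ≤ g x) xs → Any (λ x → f x < g x) xs →
  sum (map f xs) < sum (map g xs)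
sum-map-mono-< (_ ∷ ps) (here p) = +-mono-<-≤ p (sum-map-mono-≤ ps)
sum-map-mono-< (p ∷ ps) (there q) = +-mono-≤-< p (sum-map-mono-< ps q)

lookup-injective : ∀ {xs : List A} → Unique xs → ∀ i j → L.lookup xs i ≡ L.lookup xs j → i ≡ j
lookup-injective {xs = x ∷ xs} (x∉ ∷ u) zero zero eq = refl
lookup-injective {xs = x ∷ xs} (x∉ ∷ u) zero (suc j) eq = ⊥-elim (All.lookup x∉ (MP.∈-lookup j) eq)
lookup-injective {xs = x ∷ xs} (x∉ ∷ u) (suc i) zero eq = ⊥-elim (All.lookup x∉ (MP.∈-lookup i) (sym eq))
lookup-injective {xs = x ∷ xs} (x∉ ∷ u) (suc i) (suc j) eq = cong suc (lookup-injective u i j eq)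

length-≤-injection : ∀ {xs : List A} {ys : List B} (f : A → B) → Unique xs →
  (∀ {x y} → x ∈ₗ xs → y ∈ₗ xs → f x ≡ f y → x ≡ y) → (∀ {x} → x ∈ₗ xs → f x ∈ₗ ys) →
  length xs ≤ length ys
length-≤-injection {xs = xs} {ys} f u f-inj into = FP.injective⇒≤ g-injective
  where
  g : Fin (length xs) → Fin (length ys)
  g i = Any.index (into (MP.∈-lookup i))
  f∘lookup : ∀ i → f (L.lookup xs i) ≡ L.lookup ys (g i)
  f∘lookup i = lookup-index (into (MP.∈-lookup i))
  g-injective : ∀ {i j} → g i ≡ g j → i ≡ j
  g-injective {i} {j} eq = lookup-injective u i j (f-inj (MP.∈-lookup i) (MP.∈-lookup j)
    (trans (f∘lookup i) (trans (cong (L.lookup ys) eq) (sym (f∘lookup j)))))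

length-≤-⊆ : ∀ {xs ys : List A} → Unique xs → (∀ {x} → x ∈ₗ xs → x ∈ₗ ys) → length xs ≤ length ys
length-≤-⊆ u = length-≤-injection (λ x → x) u (λ _ _ eq → eq)

∸-≤-of-complement : ∀ {m b c n d} k → m + b ≡ c → n ≤ c → k + b ≤ d → (k + n) ∸ d ≤ m
∸-≤-of-complement {m} {b} {c} {n} {d} k m+b≡c n≤c k+b≤d = begin
  (k + n) ∸ d         ≤⟨ ∸-monoʳ-≤ (k + n) k+b≤d ⟩
  (k + n) ∸ (k + b)   ≡⟨ [m+n]∸[m+o]≡n∸o k n b ⟩
  n ∸ b               ≤⟨ ∸-monoˡ-≤ b n≤c ⟩
  c ∸ b               ≡⟨ cong (_∸ b) (sym m+b≡c) ⟩
  m + b ∸ b           ≡⟨ m+n∸n≡m m b ⟩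
  m                   ∎
  where open ≤-Reasoning

lookup-ext : ∀ {n} {v w : Vec A n} → (∀ i → lookup v i ≡ lookup w i) → v ≡ w
lookup-ext {v = v} {w} pointwise =
  trans (sym (VP.tabulate∘lookup v)) (trans (VP.tabulate-cong pointwise) (VP.tabulate∘lookup w))

differing-coordinate : ∀ {n} {p q : Subset n} → p ≢ q → ∃ λ i → lookup p i ≢ lookup q i
differing-coordinate {p = p} {q} p≢q with FP.any? (λ i → ¬? (lookup p i BP.≟ lookup q i))
... | yes witness = witness
... | no none = ⊥-elim (p≢q (lookup-ext λ i → decidable-stable (lookup p i BP.≟ lookup q i) (λ differ → none (i , differ))))

∉⇒lookup≡false : ∀ {n} {p : Subset n} {i} → i ∉ p → lookup p i ≡ false
∉⇒lookup≡false {p = p} {i} i∉p with lookup p i in p[i]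
... | true  = ⊥-elim (i∉p (VP.lookup⇒[]= i p p[i]))
... | false = refl

length-≤-∣∣ : ∀ {n} {S : Subset n} {xs} → Unique xs → All (_∈ S) xs → length xs ≤ ∣ S ∣
length-≤-∣∣ [] [] = z≤n
length-≤-∣∣ {S = S} {x ∷ xs} (x∉ ∷ u) (x∈S ∷ xs⊆S) =
  ≤-trans (s≤s (length-≤-∣∣ u xs⊆S-x)) (SP.x∈p⇒∣p-x∣<∣p∣ x∈S)
  where
  xs⊆S-x : All (_∈ S - x) xs
  xs⊆S-x = All.zipWith (λ (y∈S , x≢y) → SP.x∈p∧x≢y⇒x∈p-y y∈S (x≢y ∘ sym)) (xs⊆S , x∉)

data Split (m n : ℕ) : Fin (m + n) → Set where
  inˡ : ∀ i → Split m n (i ↑ˡ n)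
  inʳ : ∀ j → Split m n (m ↑ʳ j)

split : ∀ m {n} x → Split m n x
split m x with splitAt m x in eq
... | inj₁ i = subst (Split m _) (FP.splitAt⁻¹-↑ˡ eq) (inˡ i)
... | inj₂ j = subst (Split m _) (FP.splitAt⁻¹-↑ʳ eq) (inʳ j)

↑ˡ≢↑ʳ : ∀ {m n} {i : Fin m} {j : Fin n} → i ↑ˡ n ≢ m ↑ʳ j
↑ˡ≢↑ʳ {m} {n} {i} {j} eq with trans (sym (FP.splitAt-↑ˡ m i n)) (trans (cong (splitAt m) eq) (FP.splitAt-↑ʳ m n j))
... | ()

module _ {m n} {p : Subset m} {q : Subset n} where

  ∈-++⁺ˡ : ∀ {i} → i ∈ p → i ↑ˡ n ∈ p ++ᵛ q
  ∈-++⁺ˡ {i} i∈p = VP.lookup⇒[]= (i ↑ˡ n) (p ++ᵛ q) (trans (VP.lookup-++ˡ p q i) (VP.[]=⇒lookup i∈p))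

  ∈-++⁺ʳ : ∀ {j} → j ∈ q → m ↑ʳ j ∈ p ++ᵛ q
  ∈-++⁺ʳ {j} j∈q = VP.lookup⇒[]= (m ↑ʳ j) (p ++ᵛ q) (trans (VP.lookup-++ʳ p q j) (VP.[]=⇒lookup j∈q))

  ∈-++⁻ˡ : ∀ {i} → i ↑ˡ n ∈ p ++ᵛ q → i ∈ p
  ∈-++⁻ˡ {i} i∈ = VP.lookup⇒[]= i p (trans (sym (VP.lookup-++ˡ p q i)) (VP.[]=⇒lookup i∈))

  ∈-++⁻ʳ : ∀ {j} → m ↑ʳ j ∈ p ++ᵛ q → j ∈ q
  ∈-++⁻ʳ {j} j∈ = VP.lookup⇒[]= j q (trans (sym (VP.lookup-++ʳ p q j)) (VP.[]=⇒lookup j∈))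

∣⊤++∣ : ∀ m {n} (p : Subset n) → ∣ ⊤ {m} ++ᵛ p ∣ ≡ m + ∣ p ∣
∣⊤++∣ zero p = refl
∣⊤++∣ (suc m) p = cong suc (∣⊤++∣ m p)

∣⊤++⊥∣ : ∀ m n → ∣ ⊤ {m} ++ᵛ ⊥ {n} ∣ ≡ m
∣⊤++⊥∣ m n = trans (∣⊤++∣ m ⊥) (trans (cong (m +_) (SP.∣⊥∣≡0 n)) (+-identityʳ m))

∣⊥++∣ : ∀ m {n} (p : Subset n) → ∣ ⊥ {m} ++ᵛ p ∣ ≡ ∣ p ∣
∣⊥++∣ zero p = refl
∣⊥++∣ (suc m) p = ∣⊥++∣ m p

-- Labellings by proper subsets

Proper : ∀ {n} → Subset n → Set
Proper p = ∃ λ i → i ∉ p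

subsets : ∀ n → List (Subset n)
subsets zero = [] ∷ []
subsets (suc n) = map (outside ∷_) (subsets n) ++ map (inside ∷_) (subsets n)

properSubsets : ∀ n → List (Subset n)
properSubsets zero = []
properSubsets (suc n) = map (outside ∷_) (subsets n) ++ map (inside ∷_) (properSubsets n)

private
  ∷-injectiveʳ : ∀ {n b} {p q : Subset n} → b ∷ p ≡ b ∷ q → p ≡ q
  ∷-injectiveʳ refl = refl

  unique-split : ∀ {n} {xs ys : List (Subset n)} → Unique xs → Unique ys →
    Unique (map (outside ∷_) xs ++ map (inside ∷_) ys)
  unique-split {xs = xs} {ys} u v = UP.++⁺ (UP.map⁺ ∷-injectiveʳ u) (UP.map⁺ ∷-injectiveʳ v) disjoint
    where
    disjoint : ∀ {p} → ¬ (p ∈ₗ map (outside ∷_) xs × p ∈ₗ map (inside ∷_) ys)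
    disjoint (p∈ , q∈) with MP.∈-map⁻ (outside ∷_) p∈ | MP.∈-map⁻ (inside ∷_) q∈
    ... | _ , _ , refl | _ , _ , ()

  length-split : ∀ {n} (xs ys : List (Subset n)) →
    length (map (outside ∷_) xs ++ map (inside ∷_) ys) ≡ length xs + length ys
  length-split xs ys = trans (LP.length-++ (map (outside ∷_) xs))
    (cong₂ _+_ (LP.length-map (outside ∷_) xs) (LP.length-map (inside ∷_) ys))

  double : ∀ m → m + m ≡ 2 * m
  double m = cong (m +_) (sym (+-identityʳ m))

subsets-unique : ∀ n → Unique (subsets n)
subsets-unique zero = [] ∷ []
subsets-unique (suc n) = unique-split (subsets-unique n) (subsets-unique n)

properSubsets-unique : ∀ n → Unique (properSubsets n)
properSubsets-unique zero = []
properSubsets-unique (suc n) = unique-split (subsets-unique n) (properSubsets-unique n)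

∈-subsets : ∀ {n} (p : Subset n) → p ∈ₗ subsets n
∈-subsets [] = here refl
∈-subsets {suc n} (outside ∷ p) = MP.∈-++⁺ˡ (MP.∈-map⁺ (outside ∷_) (∈-subsets p))
∈-subsets {suc n} (inside ∷ p) =
  MP.∈-++⁺ʳ (map (outside ∷_) (subsets n)) (MP.∈-map⁺ (inside ∷_) (∈-subsets p))

∈-properSubsets : ∀ {n} {p : Subset n} → Proper p → p ∈ₗ properSubsets n
∈-properSubsets {suc n} {outside ∷ p} _ = MP.∈-++⁺ˡ (MP.∈-map⁺ (outside ∷_) (∈-subsets p))
∈-properSubsets {suc n} {inside ∷ p} (zero , i∉) = ⊥-elim (i∉ here)
∈-properSubsets {suc n} {inside ∷ p} (suc i , i∉) =
  MP.∈-++⁺ʳ (map (outside ∷_) (subsets n)) (MP.∈-map⁺ (inside ∷_) (∈-properSubsets (i , i∉ ∘ there)))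

∈-properSubsets⁻ : ∀ {n} {p : Subset n} → p ∈ₗ properSubsets n → Proper p
∈-properSubsets⁻ {suc n} p∈ with MP.∈-++⁻ (map (outside ∷_) (subsets n)) p∈
... | inj₁ q∈ with MP.∈-map⁻ (outside ∷_) q∈
...   | _ , _ , refl = zero , λ ()
∈-properSubsets⁻ {suc n} p∈ | inj₂ q∈ with MP.∈-map⁻ (inside ∷_) q∈
...   | q , q∈′ , refl with ∈-properSubsets⁻ q∈′
...     | i , i∉ = suc i , λ { (there i∈) → i∉ i∈ }

length-subsets : ∀ n → length (subsets n) ≡ 2 ^ n
length-subsets zero = refl
length-subsets (suc n) = begin
  length (map (outside ∷_) (subsets n) ++ map (inside ∷_) (subsets n)) ≡⟨ length-split (subsets n) (subsets n) ⟩
  length (subsets n) + length (subsets n)                                ≡⟨ cong₂ _+_ (length-subsets n) (length-subsets n) ⟩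
  2 ^ n + 2 ^ n                                                          ≡⟨ double (2 ^ n) ⟩
  2 ^ suc n                                                              ∎
  where open ≡-Reasoning

length-properSubsets : ∀ n → suc (length (properSubsets n)) ≡ 2 ^ n
length-properSubsets zero = refl
length-properSubsets (suc n) = begin
  suc (length (map (outside ∷_) (subsets n) ++ map (inside ∷_) (properSubsets n)))
    ≡⟨ cong suc (length-split (subsets n) (properSubsets n)) ⟩
  suc (length (subsets n) + length (properSubsets n))
    ≡⟨ sym (+-suc (length (subsets n)) _) ⟩
  length (subsets n) + suc (length (properSubsets n))
    ≡⟨ cong₂ _+_ (length-subsets n) (length-properSubsets n) ⟩
  2 ^ n + 2 ^ n
    ≡⟨ double (2 ^ n) ⟩
  2 ^ suc n ∎
  where open ≡-Reasoning

record Labelling (r s : ℕ) (C : List (Subset r)) : Set where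
  field
    label : Fin s → Subset r
    label-injective : ∀ {j j′} → label j ≡ label j′ → j ≡ j′
    label-proper : ∀ j → Proper (label j)
    label-onto : ∀ {p} → p ∈ₗ C → ∃ λ j → label j ≡ p

-- List the proper subsets with the members of C first and label by the first s of them.
module _ {r s : ℕ} (C : List (Subset r)) (C-proper : All Proper C) (C≤s : length C ≤ s) (s<2^r : s < 2 ^ r) where
  open import Data.List.Membership.DecPropositional (VP.≡-dec {n = r} BP._≟_) using () renaming (_∈?_ to _∈C?_)

  private
    chosen rest ordered : List (Subset r)
    chosen = filter (_∈C? C) (properSubsets r)
    rest = filter (¬? ∘ (_∈C? C)) (properSubsets r)
    ordered = chosen ++ rest

    ∈-chosen⁻ : ∀ {p} → p ∈ₗ chosen → p ∈ₗ properSubsets r × p ∈ₗ C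
    ∈-chosen⁻ = MP.∈-filter⁻ (_∈C? C) {xs = properSubsets r}

    ordered-unique : Unique ordered
    ordered-unique = UP.++⁺ (UP.filter⁺ (_∈C? C) (properSubsets-unique r))
                            (UP.filter⁺ (¬? ∘ (_∈C? C)) (properSubsets-unique r))
      λ (p∈ , q∈) → proj₂ (MP.∈-filter⁻ (¬? ∘ (_∈C? C)) {xs = properSubsets r} q∈) (proj₂ (∈-chosen⁻ p∈))

    s≤ordered : s ≤ length ordered
    s≤ordered = begin
      s                                                     ≤⟨ s≤s⁻¹ (subst (suc s ≤_) (sym (length-properSubsets r)) s<2^r) ⟩
      length (properSubsets r)                              ≡⟨ sym (length-filter+length-filter-¬ (_∈C? C) (properSubsets r)) ⟩
      length chosen + length rest                           ≡⟨ sym (LP.length-++ chosen) ⟩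
      length ordered                                        ∎
      where open ≤-Reasoning

    label : Fin s → Subset r
    label j = L.lookup ordered (F.inject≤ j s≤ordered)

    ∈-ordered⁻ : ∀ {p} → p ∈ₗ ordered → Proper p
    ∈-ordered⁻ p∈ with MP.∈-++⁻ chosen p∈
    ... | inj₁ q∈ = ∈-properSubsets⁻ (proj₁ (∈-chosen⁻ q∈))
    ... | inj₂ q∈ = ∈-properSubsets⁻ (proj₁ (MP.∈-filter⁻ (¬? ∘ (_∈C? C)) {xs = properSubsets r} q∈))

    label-onto : ∀ {p} → p ∈ₗ C → ∃ λ j → label j ≡ p
    label-onto {p} p∈C = j , (begin
      L.lookup ordered (F.inject≤ j s≤ordered) ≡⟨ cong (L.lookup ordered) index-agrees ⟩
      L.lookup ordered (Any.index p∈ordered)   ≡⟨ sym (lookup-index p∈ordered) ⟩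
      p                                         ∎)
      where
      open ≡-Reasoning
      p∈chosen : p ∈ₗ chosen
      p∈chosen = MP.∈-filter⁺ (_∈C? C) (∈-properSubsets (All.lookup C-proper p∈C)) p∈C
      p∈ordered : p ∈ₗ ordered
      p∈ordered = MP.∈-++⁺ˡ p∈chosen
      index<s : F.toℕ (Any.index p∈chosen) < s
      index<s = ≤-trans (FP.toℕ<n (Any.index p∈chosen))
                  (≤-trans (length-≤-⊆ (UP.filter⁺ (_∈C? C) (properSubsets-unique r)) (proj₂ ∘ ∈-chosen⁻)) C≤s)
      j : Fin s
      j = F.fromℕ< index<s
      index-agrees : F.inject≤ j s≤ordered ≡ Any.index p∈ordered
      index-agrees = FP.toℕ-injective (begin
        F.toℕ (F.inject≤ j s≤ordered) ≡⟨ FP.toℕ-inject≤ j s≤ordered ⟩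
        F.toℕ j                       ≡⟨ FP.toℕ-fromℕ< index<s ⟩
        F.toℕ (Any.index p∈chosen)    ≡⟨ sym (toℕ-index-++ˡ p∈chosen) ⟩
        F.toℕ (Any.index p∈ordered)   ∎)
        where
        toℕ-index-++ˡ : ∀ {x : Subset r} {xs ys} (x∈ : x ∈ₗ xs) →
          F.toℕ (Any.index (MP.∈-++⁺ˡ {ys = ys} x∈)) ≡ F.toℕ (Any.index x∈)
        toℕ-index-++ˡ (here refl) = refl
        toℕ-index-++ˡ (there x∈) = cong suc (toℕ-index-++ˡ x∈)

  labelling : Labelling r s C
  labelling = record
    { label = label
    ; label-injective = λ {j} {j′} eq → FP.inject≤-injective s≤ordered s≤ordered j j′
        (lookup-injective ordered-unique _ _ eq)
    ; label-proper = λ j → ∈-ordered⁻ (MP.∈-lookup (F.inject≤ j s≤ordered))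
    ; label-onto = label-onto
    }

_◅◅_ : ∀ {n} {X : Graph n} {x y z} → Reach X x y → Reach X y z → Reach X x z
here ◅◅ y⇝z = y⇝z
step x~w w⇝y ◅◅ y⇝z = step x~w (w⇝y ◅◅ y⇝z)

module _ {n} (X : Graph n) (S : Subset n) where
  private
    lookup-trace : ∀ x z → lookup (N X x ∩ S) z ≡ adj X x z ∧ lookup S z
    lookup-trace x z = trans (VP.lookup-zipWith _∧_ z (N X x) S) (cong (_∧ lookup S z) (VP.lookup∘tabulate (adj X x) z))

  trace-≡ : ∀ {x y} → (∀ {z} → z ∈ S → adj X x z ≡ adj X y z) → N X x ∩ S ≡ N X y ∩ S
  trace-≡ {x} {y} agree = lookup-ext pointwise
    where
    pointwise : ∀ z → lookup (N X x ∩ S) z ≡ lookup (N X y ∩ S) z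
    pointwise z = trans (lookup-trace x z) (trans masked (sym (lookup-trace y z)))
      where
      masked : adj X x z ∧ lookup S z ≡ adj X y z ∧ lookup S z
      masked with lookup S z in z∈?S
      ... | true  = cong (_∧ true) (agree (VP.lookup⇒[]= z S z∈?S))
      ... | false = trans (BP.∧-zeroʳ _) (sym (BP.∧-zeroʳ _))

  trace-≢ : ∀ {x y z} → z ∈ S → adj X x z ≢ adj X y z → N X x ∩ S ≢ N X y ∩ S
  trace-≢ {x} {y} {z} z∈S differ eq = differ (begin
    adj X x z                   ≡⟨ BP.∧-identityʳ _ ⟨
    adj X x z ∧ true            ≡⟨ cong (adj X x z ∧_) (VP.[]=⇒lookup z∈S) ⟨
    adj X x z ∧ lookup S z      ≡⟨ lookup-trace x z ⟨
    lookup (N X x ∩ S) z        ≡⟨ cong (λ v → lookup v z) eq ⟩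
    lookup (N X y ∩ S) z        ≡⟨ lookup-trace y z ⟩
    adj X y z ∧ lookup S z      ≡⟨ cong (adj X y z ∧_) (VP.[]=⇒lookup z∈S) ⟩
    adj X y z ∧ true            ≡⟨ BP.∧-identityʳ _ ⟩
    adj X y z                   ∎)
    where open ≡-Reasoning

-- Blocks of coordinates

-- If S contains y of the b coordinate vertices of a block, it separates at most 2 ^ y of the
-- vertices labelled by the block's n patterns, so it contains at least n ∸ 2 ^ y of those.
-- Ample b n says that this always gives b vertices of S, and Ample⁺ b n that it gives b + 1
-- when y < b and one more vertex, labelled ∅, lies outside S.
Ample : ℕ → ℕ → Set
Ample b n = ∀ y → y ≤ b → b ≤ y + (n ∸ 2 ^ y)

Ample⁺ : ℕ → ℕ → Set
Ample⁺ b n = ∀ y → y < b → suc b ≤ y + (suc n ∸ 2 ^ y)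

record PatternBlock (n : ℕ) : Set where
  field
    coords : List (Fin n)
    patterns : List (Subset n)
    coords-unique : Unique coords
    patterns-unique : Unique patterns
    patterns-nonempty : ∀ {p} → p ∈ₗ patterns → Nonempty p
    patterns-supported : ∀ {p} → p ∈ₗ patterns → ∀ {i} → i ∈ p → i ∈ₗ coords
    ample : Ample (length coords) (length patterns)
    ample⁺ : Ample⁺ (length coords) (length patterns)
open PatternBlock public

record Decomposition (n : ℕ) : Set where
  field
    blocks : List (PatternBlock n)
    disjoint : AllPairs (λ B B′ → Disjoint (coords B) (coords B′)) blocks
    covering : ∀ i → Any (λ B → i ∈ₗ coords B) blocks
open Decomposition public

record Embedding (m n : ℕ) : Set where
  field
    embed : Fin m → Fin n
    embed-injective : ∀ {i j} → embed i ≡ embed j → i ≡ j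
    embedˢ : Subset m → Subset n
    embedˢ-injective : ∀ {p q} → embedˢ p ≡ embedˢ q → p ≡ q
    ∈-embedˢ⁺ : ∀ {p i} → i ∈ p → embed i ∈ embedˢ p
    ∈-embedˢ⁻ : ∀ {p i} → i ∈ embedˢ p → ∃ λ k → i ≡ embed k × k ∈ p

↑ˡ-embedding : ∀ m n → Embedding m (m + n)
↑ˡ-embedding m n = record
  { embed = _↑ˡ n
  ; embed-injective = FP.↑ˡ-injective n _ _
  ; embedˢ = _++ᵛ ⊥
  ; embedˢ-injective = VP.++-injectiveˡ _ _
  ; ∈-embedˢ⁺ = ∈-++⁺ˡ
  ; ∈-embedˢ⁻ = λ {p} → ∈-embedˢ⁻ p _
  }
  where
  ∈-embedˢ⁻ : ∀ p i → i ∈ p ++ᵛ ⊥ {n} → ∃ λ k → i ≡ k ↑ˡ n × k ∈ p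
  ∈-embedˢ⁻ p i i∈ with split m i
  ... | inˡ k = k , refl , ∈-++⁻ˡ i∈
  ... | inʳ j = ⊥-elim (SP.∉⊥ (∈-++⁻ʳ {p = p} i∈))

↑ʳ-embedding : ∀ m n → Embedding n (m + n)
↑ʳ-embedding m n = record
  { embed = m ↑ʳ_
  ; embed-injective = FP.↑ʳ-injective m _ _
  ; embedˢ = ⊥ ++ᵛ_
  ; embedˢ-injective = VP.++-injectiveʳ ⊥ ⊥
  ; ∈-embedˢ⁺ = ∈-++⁺ʳ
  ; ∈-embedˢ⁻ = λ {p} → ∈-embedˢ⁻ p _
  }
  where
  ∈-embedˢ⁻ : ∀ p i → i ∈ ⊥ {m} ++ᵛ p → ∃ λ k → i ≡ m ↑ʳ k × k ∈ p
  ∈-embedˢ⁻ p i i∈ with split m i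
  ... | inˡ k = ⊥-elim (SP.∉⊥ (∈-++⁻ˡ {q = p} i∈))
  ... | inʳ k = k , refl , ∈-++⁻ʳ i∈

liftBlock : ∀ {m n} → Embedding m n → PatternBlock m → PatternBlock n
liftBlock e B = record
  { coords = map embed (coords B)
  ; patterns = map embedˢ (patterns B)
  ; coords-unique = UP.map⁺ embed-injective (coords-unique B)
  ; patterns-unique = UP.map⁺ embedˢ-injective (patterns-unique B)
  ; patterns-nonempty = nonempty
  ; patterns-supported = supported
  ; ample = subst₂ Ample (sym (LP.length-map embed (coords B))) (sym (LP.length-map embedˢ (patterns B))) (ample B)
  ; ample⁺ = subst₂ Ample⁺ (sym (LP.length-map embed (coords B))) (sym (LP.length-map embedˢ (patterns B))) (ample⁺ B)
  }
  where
  open Embedding e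
  nonempty : ∀ {p} → p ∈ₗ map embedˢ (patterns B) → Nonempty p
  nonempty p∈ with MP.∈-map⁻ embedˢ p∈
  ... | q , q∈ , refl with patterns-nonempty B q∈
  ...   | i , i∈q = embed i , ∈-embedˢ⁺ i∈q
  supported : ∀ {p} → p ∈ₗ map embedˢ (patterns B) → ∀ {i} → i ∈ p → i ∈ₗ map embed (coords B)
  supported p∈ i∈ with MP.∈-map⁻ embedˢ p∈
  ... | q , q∈ , refl with ∈-embedˢ⁻ i∈
  ...   | k , refl , k∈q = MP.∈-map⁺ embed (patterns-supported B q∈ k∈q)

length-patterns-liftBlock : ∀ {m n} (e : Embedding m n) B → length (patterns (liftBlock e B)) ≡ length (patterns B)
length-patterns-liftBlock e B = LP.length-map (Embedding.embedˢ e) (patterns B)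

patternCount : ∀ {n} → Decomposition n → ℕ
patternCount D = sum (map (length ∘ patterns) (blocks D))

emptyDecomposition : Decomposition 0
emptyDecomposition = record { blocks = [] ; disjoint = [] ; covering = λ () }

extend : ∀ {b n} (B : PatternBlock b) → (∀ k → k ∈ₗ coords B) → Decomposition n → Decomposition (b + n)
extend {b} {n} B B-full D = record
  { blocks = liftBlock (↑ˡ-embedding b n) B ∷ map (liftBlock (↑ʳ-embedding b n)) (blocks D)
  ; disjoint = AllP.map⁺ (All.tabulate (λ {B′} _ → new-disjoint {B′}))
             ∷ AllPairsP.map⁺ (AllPairs.map (λ {B₁} {B₂} → old-disjoint {B₁} {B₂}) (disjoint D))
  ; covering = covering′
  }
  where
  new-disjoint : ∀ {B′} → Disjoint (map (_↑ˡ n) (coords B)) (map (b ↑ʳ_) (coords B′))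
  new-disjoint (x∈ , x∈′) with MP.∈-map⁻ (_↑ˡ n) x∈ | MP.∈-map⁻ (b ↑ʳ_) x∈′
  ... | _ , _ , refl | _ , _ , eq = ↑ˡ≢↑ʳ eq
  old-disjoint : ∀ {B₁ B₂} → Disjoint (coords B₁) (coords B₂) →
    Disjoint (map (b ↑ʳ_) (coords B₁)) (map (b ↑ʳ_) (coords B₂))
  old-disjoint disj (x∈₁ , x∈₂) with MP.∈-map⁻ (b ↑ʳ_) x∈₁ | MP.∈-map⁻ (b ↑ʳ_) x∈₂
  ... | k₁ , k₁∈ , refl | k₂ , k₂∈ , eq = disj (k₁∈ , subst (_∈ₗ _) (sym (FP.↑ʳ-injective b _ _ eq)) k₂∈)
  covering′ : ∀ i → Any (λ B′ → i ∈ₗ coords B′)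
    (liftBlock (↑ˡ-embedding b n) B ∷ map (liftBlock (↑ʳ-embedding b n)) (blocks D))
  covering′ i with split b i
  ... | inˡ k = here (MP.∈-map⁺ (_↑ˡ n) (B-full k))
  ... | inʳ k = there (AnyP.map⁺ (Any.map (MP.∈-map⁺ (b ↑ʳ_)) (covering D k)))

patternCount-extend : ∀ {b n} (B : PatternBlock b) (full : ∀ k → k ∈ₗ coords B) (D : Decomposition n) →
  patternCount (extend B full D) ≡ length (patterns B) + patternCount D
patternCount-extend {b} {n} B full D = cong₂ _+_ (length-patterns-liftBlock (↑ˡ-embedding b n) B) (begin
  sum (map (length ∘ patterns) (map (liftBlock (↑ʳ-embedding b n)) (blocks D)))
    ≡⟨ cong sum (LP.map-∘ (blocks D)) ⟨
  sum (map (length ∘ patterns ∘ liftBlock (↑ʳ-embedding b n)) (blocks D))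
    ≡⟨ cong sum (LP.map-cong (length-patterns-liftBlock (↑ʳ-embedding b n)) (blocks D)) ⟩
  sum (map (length ∘ patterns) (blocks D)) ∎)
  where open ≡-Reasoning

ample-2-3 : Ample 2 3
ample-2-3 0 _ = ≤-refl
ample-2-3 1 _ = ≤-refl
ample-2-3 2 _ = ≤-refl
ample-2-3 (suc (suc (suc _))) (s≤s (s≤s ()))

ample⁺-2-3 : Ample⁺ 2 3
ample⁺-2-3 0 _ = ≤-refl
ample⁺-2-3 1 _ = ≤-refl
ample⁺-2-3 (suc (suc _)) (s≤s (s≤s ()))

ample-3-5 : Ample 3 5
ample-3-5 0 _ = ≤ᵇ⇒≤ _ _ _
ample-3-5 1 _ = ≤ᵇ⇒≤ _ _ _
ample-3-5 2 _ = ≤ᵇ⇒≤ _ _ _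
ample-3-5 3 _ = ≤ᵇ⇒≤ _ _ _
ample-3-5 (suc (suc (suc (suc _)))) (s≤s (s≤s (s≤s ())))

ample⁺-3-5 : Ample⁺ 3 5
ample⁺-3-5 0 _ = ≤ᵇ⇒≤ _ _ _
ample⁺-3-5 1 _ = ≤ᵇ⇒≤ _ _ _
ample⁺-3-5 2 _ = ≤ᵇ⇒≤ _ _ _
ample⁺-3-5 (suc (suc (suc _))) (s≤s (s≤s (s≤s ())))

pairBlock : PatternBlock 2
pairBlock = record
  { coords = L.allFin 2
  ; patterns = (inside ∷ outside ∷ []) ∷ (outside ∷ inside ∷ []) ∷ (inside ∷ inside ∷ []) ∷ []
  ; coords-unique = UP.allFin⁺ 2
  ; patterns-unique = ((λ ()) ∷ (λ ()) ∷ []) ∷ ((λ ()) ∷ []) ∷ [] ∷ []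
  ; patterns-nonempty = λ where
      (here refl) → zero , here
      (there (here refl)) → suc zero , there here
      (there (there (here refl))) → zero , here
  ; patterns-supported = λ _ {i} _ → MP.∈-allFin i
  ; ample = ample-2-3
  ; ample⁺ = ample⁺-2-3
  }

tripleBlock : PatternBlock 3
tripleBlock = record
  { coords = L.allFin 3
  ; patterns = (inside ∷ outside ∷ outside ∷ []) ∷ (outside ∷ inside ∷ outside ∷ []) ∷ (inside ∷ inside ∷ outside ∷ [])
             ∷ (outside ∷ outside ∷ inside ∷ []) ∷ (inside ∷ outside ∷ inside ∷ []) ∷ []
  ; coords-unique = UP.allFin⁺ 3
  ; patterns-unique = ((λ ()) ∷ (λ ()) ∷ (λ ()) ∷ (λ ()) ∷ []) ∷ ((λ ()) ∷ (λ ()) ∷ (λ ()) ∷ [])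
                    ∷ ((λ ()) ∷ (λ ()) ∷ []) ∷ ((λ ()) ∷ []) ∷ [] ∷ []
  ; patterns-nonempty = λ where
      (here refl) → zero , here
      (there (here refl)) → suc zero , there here
      (there (there (here refl))) → zero , here
      (there (there (there (here refl)))) → suc (suc zero) , there (there here)
      (there (there (there (there (here refl))))) → zero , here
  ; patterns-supported = λ _ {i} _ → MP.∈-allFin i
  ; ample = ample-3-5
  ; ample⁺ = ample⁺-3-5
  }

tripleBlock-proper : ∀ {p} → p ∈ₗ patterns tripleBlock → Proper p
tripleBlock-proper (here refl) = suc zero , λ { (there ()) }
tripleBlock-proper (there (here refl)) = zero , λ ()
tripleBlock-proper (there (there (here refl))) = suc (suc zero) , λ { (there (there ())) }
tripleBlock-proper (there (there (there (here refl)))) = zero , λ ()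
tripleBlock-proper (there (there (there (there (here refl))))) = suc zero , λ { (there ()) }

decomposition : ∀ n → Decomposition (2 + n)
decomposition 0 = extend pairBlock MP.∈-allFin emptyDecomposition
decomposition 1 = extend tripleBlock MP.∈-allFin emptyDecomposition
decomposition (suc (suc n)) = extend pairBlock MP.∈-allFin (decomposition n)

patternCount-decomposition : ∀ n → 2 * patternCount (decomposition n) ≤ 3 * (2 + n) + 1
patternCount-decomposition 0 = ≤ᵇ⇒≤ _ _ _
patternCount-decomposition 1 = ≤ᵇ⇒≤ _ _ _
patternCount-decomposition (suc (suc n)) = begin
  2 * patternCount (decomposition (suc (suc n)))  ≡⟨ cong (2 *_) (patternCount-extend pairBlock MP.∈-allFin (decomposition n)) ⟩
  2 * (3 + patternCount (decomposition n))        ≡⟨ *-distribˡ-+ 2 3 _ ⟩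
  6 + 2 * patternCount (decomposition n)          ≤⟨ +-monoʳ-≤ 6 (patternCount-decomposition n) ⟩
  6 + (3 * (2 + n) + 1)                           ≡⟨ +-assoc 6 (3 * (2 + n)) 1 ⟨
  6 + 3 * (2 + n) + 1                             ≡⟨ cong (_+ 1) (*-distribˡ-+ 3 2 (2 + n)) ⟨
  3 * (2 + (2 + n)) + 1                           ∎
  where open ≤-Reasoning

decomposition-proper : ∀ n {B} → B ∈ₗ blocks (decomposition (suc n)) → ∀ {p} → p ∈ₗ patterns B → Proper p
decomposition-proper zero (here refl) p∈ with MP.∈-map⁻ (λ (q : Subset 3) → q ++ᵛ ⊥ {0}) {xs = patterns tripleBlock} p∈
... | q , q∈ , refl with tripleBlock-proper q∈
...   | k , k∉q = k ↑ˡ 0 , k∉q ∘ ∈-++⁻ˡ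
decomposition-proper (suc n) (here refl) p∈ with MP.∈-map⁻ (λ (q : Subset 2) → q ++ᵛ ⊥ {2 + n}) {xs = patterns pairBlock} p∈
... | q , _ , refl = 2 ↑ʳ zero , SP.∉⊥ ∘ ∈-++⁻ʳ {p = q}
decomposition-proper (suc n) (there B∈) p∈ with MP.∈-map⁻ (liftBlock (↑ʳ-embedding 2 (2 + n))) B∈
... | B′ , _ , refl with MP.∈-map⁻ (⊥ {2} ++ᵛ_) p∈
...   | q , _ , refl = zero , SP.∉⊥ ∘ ∈-++⁻ˡ {q = q}

-- The graph of a labelling

module Construction {r s : ℕ} (T : Fin s → Subset r) where

  U : Fin r → Fin (r + s)
  U i = i ↑ˡ s

  W : Fin s → Fin (r + s)
  W j = r ↑ʳ j

  side : ∀ x → Split r s x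
  side = split r

  U≢W : ∀ {i j} → U i ≢ W j
  U≢W = ↑ˡ≢↑ʳ

  U-injective : ∀ {i i′} → U i ≡ U i′ → i ≡ i′
  U-injective = FP.↑ˡ-injective s _ _

  W-injective : ∀ {j j′} → W j ≡ W j′ → j ≡ j′
  W-injective = FP.↑ʳ-injective r _ _

  private
    edge : Fin r ⊎ Fin s → Fin r ⊎ Fin s → Bool
    edge (inj₁ i) (inj₂ j) = not (lookup (T j) i)
    edge (inj₂ j) (inj₁ i) = not (lookup (T j) i)
    edge (inj₁ _) (inj₁ _) = false
    edge (inj₂ _) (inj₂ _) = false

    edge-sym : ∀ a b → edge a b ≡ edge b a
    edge-sym (inj₁ _) (inj₁ _) = refl
    edge-sym (inj₁ _) (inj₂ _) = refl
    edge-sym (inj₂ _) (inj₁ _) = refl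
    edge-sym (inj₂ _) (inj₂ _) = refl

    edge-irrefl : ∀ a → edge a a ≡ false
    edge-irrefl (inj₁ _) = refl
    edge-irrefl (inj₂ _) = refl

  G : Graph (r + s)
  adj G x y = edge (splitAt r x) (splitAt r y)
  adj-sym G x y = edge-sym (splitAt r x) (splitAt r y)
  adj-irrefl G x = edge-irrefl (splitAt r x)

  H : Graph (r + s)
  H = complement G

  adj-WU : ∀ j i → adj G (W j) (U i) ≡ not (lookup (T j) i)
  adj-WU j i rewrite FP.splitAt-↑ʳ r s j | FP.splitAt-↑ˡ r i s = refl

  adj-UU : ∀ i i′ → adj G (U i) (U i′) ≡ false
  adj-UU i i′ rewrite FP.splitAt-↑ˡ r i s | FP.splitAt-↑ˡ r i′ s = refl

  adj-WW : ∀ j j′ → adj G (W j) (W j′) ≡ false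
  adj-WW j j′ rewrite FP.splitAt-↑ʳ r s j | FP.splitAt-↑ʳ r s j′ = refl

  private
    distinct : ∀ {x y : Fin (r + s)} → x ≢ y → not (does (x F.≟ y)) ≡ true
    distinct {x} {y} x≢y with x F.≟ y
    ... | yes x≡y = ⊥-elim (x≢y x≡y)
    ... | no _    = refl

  adjᶜ-WU : ∀ j i → adj H (W j) (U i) ≡ lookup (T j) i
  adjᶜ-WU j i = begin
    not (adj G (W j) (U i)) ∧ not (does (W j F.≟ U i)) ≡⟨ cong₂ _∧_ (cong not (adj-WU j i)) (distinct (U≢W ∘ sym)) ⟩
    not (not (lookup (T j) i)) ∧ true                 ≡⟨ BP.∧-identityʳ _ ⟩
    not (not (lookup (T j) i))                        ≡⟨ BP.not-involutive _ ⟩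
    lookup (T j) i                                    ∎
    where open ≡-Reasoning

  adjᶜ-WW : ∀ {j j′} → j ≢ j′ → Adj H (W j) (W j′)
  adjᶜ-WW {j} {j′} j≢j′ = cong₂ _∧_ (cong not (adj-WW j j′)) (distinct (j≢j′ ∘ W-injective))

  module _ (T-injective : ∀ {j j′} → T j ≡ T j′ → j ≡ j′) where

    W-distinguished : ∀ (X : Graph (r + s)) {S} → (∀ i → U i ∈ S) →
      (∀ {j j′ i} → adj X (W j) (U i) ≡ adj X (W j′) (U i) → lookup (T j) i ≡ lookup (T j′) i) →
      Distinguishing X S
    W-distinguished X {S} U⊆S X-WU x y x∉S y∉S x≢y with side x | side y
    ... | inˡ i | _     = ⊥-elim (x∉S (U⊆S i))
    ... | inʳ _ | inˡ i = ⊥-elim (y∉S (U⊆S i))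
    ... | inʳ j | inʳ j′ with differing-coordinate (x≢y ∘ cong W ∘ T-injective)
    ...   | i , differ = trace-≢ X S (U⊆S i) (differ ∘ X-WU)

    U-locating-dominatingᴳ : (∀ j → Proper (T j)) → LocatingDominating G (⊤ {r} ++ᵛ ⊥ {s})
    U-locating-dominatingᴳ T-proper = W-distinguished G (λ i → ∈-++⁺ˡ SP.∈⊤)
        (λ {j} {j′} {i} same → BP.not-injective (trans (sym (adj-WU j i)) (trans same (adj-WU j′ i))))
      , dominating
      where
      dominating : Dominating G (⊤ {r} ++ᵛ ⊥ {s})
      dominating x x∉ with side x
      ... | inˡ i = ⊥-elim (x∉ (∈-++⁺ˡ SP.∈⊤))
      ... | inʳ j with T-proper j
      ...   | i , i∉Tj = U i , ∈-++⁺ˡ SP.∈⊤ , trans (adj-WU j i) (cong not (∉⇒lookup≡false i∉Tj))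

    U+W-j₀-locating-dominatingᴴ : ∀ j₀ → LocatingDominating H (⊤ {r} ++ᵛ ⁅ j₀ ⁆)
    U+W-j₀-locating-dominatingᴴ j₀ = W-distinguished H (λ i → ∈-++⁺ˡ SP.∈⊤)
        (λ {j} {j′} {i} same → trans (sym (adjᶜ-WU j i)) (trans same (adjᶜ-WU j′ i)))
      , dominating
      where
      dominating : Dominating H (⊤ {r} ++ᵛ ⁅ j₀ ⁆)
      dominating x x∉ with side x
      ... | inˡ i = ⊥-elim (x∉ (∈-++⁺ˡ SP.∈⊤))
      ... | inʳ j = W j₀ , ∈-++⁺ʳ (SP.x∈⁅x⁆ j₀) , adjᶜ-WW λ { refl → x∉ (∈-++⁺ʳ (SP.x∈⁅x⁆ j₀)) }

  connectedᴳ : (∀ j → Proper (T j)) → ∀ {j₀} → T j₀ ≡ ⊥ → Connected G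
  connectedᴳ T-proper {j₀} T-j₀ x y = to-W-j₀ x ◅◅ from-W-j₀ y
    where
    W-j₀~U : ∀ i → Adj G (W j₀) (U i)
    W-j₀~U i = trans (adj-WU j₀ i) (cong not (trans (cong (λ p → lookup p i) T-j₀) (VP.lookup-replicate i false)))
    U-neighbour : ∀ j → ∃ λ i → Adj G (W j) (U i)
    U-neighbour j with T-proper j
    ... | i , i∉Tj = i , trans (adj-WU j i) (cong not (∉⇒lookup≡false i∉Tj))
    from-W-j₀ : ∀ y → Reach G (W j₀) y
    from-W-j₀ y with side y
    ... | inˡ i = step (W-j₀~U i) here
    ... | inʳ j with U-neighbour j
    ...   | i , Wj~Ui = step (W-j₀~U i) (step (trans (adj-sym G (U i) (W j)) Wj~Ui) here)
    to-W-j₀ : ∀ x → Reach G x (W j₀)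
    to-W-j₀ x with side x
    ... | inˡ i = step (trans (adj-sym G (U i) (W j₀)) (W-j₀~U i)) here
    ... | inʳ j with U-neighbour j
    ...   | i , Wj~Ui = step Wj~Ui (step (trans (adj-sym G (U i) (W j₀)) (W-j₀~U i)) here)

  bipartiteᴳ : BipartiteWithParts G r s
  bipartiteᴳ = ⊤ {r} ++ᵛ ⊥ {s} , ⊥ {r} ++ᵛ ⊤ {s} , cover , separate , stableᵁ , stableᵂ
             , ∣⊤++⊥∣ r s
             , trans (∣⊥++∣ r ⊤) (SP.∣⊤∣≡n s)
    where
    cover : ∀ x → x ∈ ⊤ {r} ++ᵛ ⊥ {s} ⊎ x ∈ ⊥ {r} ++ᵛ ⊤ {s}
    cover x with side x
    ... | inˡ i = inj₁ (∈-++⁺ˡ {q = ⊥ {s}} SP.∈⊤)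
    ... | inʳ j = inj₂ (∈-++⁺ʳ {p = ⊥ {r}} SP.∈⊤)
    separate : ∀ x → x ∈ ⊤ {r} ++ᵛ ⊥ {s} → x ∉ ⊥ {r} ++ᵛ ⊤ {s}
    separate x x∈ with side x
    ... | inˡ i = SP.∉⊥ ∘ ∈-++⁻ˡ {q = ⊤ {s}}
    ... | inʳ j = λ _ → SP.∉⊥ (∈-++⁻ʳ {p = ⊤ {r}} x∈)
    stableᵁ : Stable G (⊤ {r} ++ᵛ ⊥ {s})
    stableᵁ x y x∈ y∈ with side x | side y
    ... | inʳ j | _     = λ _ → SP.∉⊥ (∈-++⁻ʳ {p = ⊤ {r}} x∈)
    ... | inˡ _ | inʳ j = λ _ → SP.∉⊥ (∈-++⁻ʳ {p = ⊤ {r}} y∈)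
    ... | inˡ i | inˡ i′ = λ Ui~Ui′ → case trans (sym Ui~Ui′) (adj-UU i i′) of λ ()
    stableᵂ : Stable G (⊥ {r} ++ᵛ ⊤ {s})
    stableᵂ x y x∈ y∈ with side x | side y
    ... | inˡ i | _     = λ _ → SP.∉⊥ (∈-++⁻ˡ {q = ⊤ {s}} x∈)
    ... | inʳ _ | inˡ i = λ _ → SP.∉⊥ (∈-++⁻ˡ {q = ⊤ {s}} y∈)
    ... | inʳ j | inʳ j′ = λ Wj~Wj′ → case trans (sym Wj~Wj′) (adj-WW j j′) of λ ()

  Separating : Subset (r + s) → Set
  Separating S = ∀ {j j′} → j ≢ j′ →
    W j ∈ S ⊎ W j′ ∈ S ⊎ ∃ λ i → U i ∈ S × lookup (T j) i ≢ lookup (T j′) i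

  module _ (X : Graph (r + s))
    (X-WU : ∀ {j j′ i} → lookup (T j) i ≡ lookup (T j′) i → adj X (W j) (U i) ≡ adj X (W j′) (U i))
    (X-WW : ∀ {j j′ j″} → j″ ≢ j → j″ ≢ j′ → adj X (W j) (W j″) ≡ adj X (W j′) (W j″)) where

    distinguishing⇒separating : ∀ {S} → Distinguishing X S → Separating S
    distinguishing⇒separating {S} dist {j} {j′} j≢j′ with W j SP.∈? S | W j′ SP.∈? S
    ... | yes Wj∈S | _ = inj₁ Wj∈S
    ... | no _ | yes Wj′∈S = inj₂ (inj₁ Wj′∈S)
    ... | no Wj∉S | no Wj′∉S with FP.any? (λ i → U i SP.∈? S ×-dec ¬? (lookup (T j) i BP.≟ lookup (T j′) i))
    ...   | yes witness = inj₂ (inj₂ witness)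
    ...   | no none = ⊥-elim (dist (W j) (W j′) Wj∉S Wj′∉S (j≢j′ ∘ W-injective) (trace-≡ X S agree))
      where
      agree : ∀ {z} → z ∈ S → adj X (W j) z ≡ adj X (W j′) z
      agree {z} z∈S with side z
      ... | inˡ i with lookup (T j) i BP.≟ lookup (T j′) i
      ...   | yes same = X-WU same
      ...   | no differ = ⊥-elim (none (i , z∈S , differ))
      agree z∈S | inʳ j″ = X-WW (λ { refl → Wj∉S z∈S }) (λ { refl → Wj′∉S z∈S })

  distinguishing⇒separatingᴳ : ∀ {S} → Distinguishing G S → Separating S
  distinguishing⇒separatingᴳ = distinguishing⇒separating G
    (λ {j} {j′} {i} same → trans (adj-WU j i) (trans (cong not same) (sym (adj-WU j′ i))))
    (λ {j} {j′} {j″} _ _ → trans (adj-WW j j″) (sym (adj-WW j′ j″)))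

  distinguishing⇒separatingᴴ : ∀ {S} → Distinguishing H S → Separating S
  distinguishing⇒separatingᴴ = distinguishing⇒separating H
    (λ {j} {j′} {i} same → trans (adjᶜ-WU j i) (trans same (sym (adjᶜ-WU j′ i))))
    (λ j″≢j j″≢j′ → trans (adjᶜ-WW (j″≢j ∘ sym)) (sym (adjᶜ-WW (j″≢j′ ∘ sym))))

  _∩ᵁ_ : Subset (r + s) → List (Fin r) → List (Fin r)
  S ∩ᵁ cs = filter (λ i → U i SP.∈? S) cs

  _∩ᵂ_ : Subset (r + s) → List (Fin s) → List (Fin s)
  S ∩ᵂ ws = filter (λ j → W j SP.∈? S) ws

  _∖ᵂ_ : List (Fin s) → Subset (r + s) → List (Fin s)
  ws ∖ᵂ S = filter (λ j → ¬? (W j SP.∈? S)) ws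

  -- Pigeonhole: two vertices of ws outside S differ at a coordinate of cs whose vertex lies in S,
  -- so projecting onto those coordinates is injective on them.
  unselected-≤ : ∀ {S} → Separating S → ∀ cs {ws} → Unique ws →
    (∀ {j} → j ∈ₗ ws → ∀ {i} → i ∈ T j → i ∈ₗ cs) → length (ws ∖ᵂ S) ≤ 2 ^ length (S ∩ᵁ cs)
  unselected-≤ {S} sep cs {ws} ws-unique supported =
    ≤-trans (length-≤-injection project (UP.filter⁺ _ ws-unique) project-injective (λ _ → ∈-subsets _))
            (≤-reflexive (length-subsets (length ys)))
    where
    ys = S ∩ᵁ cs

    project : Fin s → Subset (length ys)
    project j = tabulate (λ k → lookup (T j) (L.lookup ys k))

    unselected : ∀ {j} → j ∈ₗ ws ∖ᵂ S → W j ∉ S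
    unselected = proj₂ ∘ MP.∈-filter⁻ (λ j → ¬? (W j SP.∈? S)) {xs = ws}

    differ⇒∈ : ∀ {p q : Subset r} {i} → lookup p i ≢ lookup q i → i ∈ p ⊎ i ∈ q
    differ⇒∈ {p} {q} {i} differ with lookup p i in p[i] | lookup q i in q[i]
    ... | true  | _     = inj₁ (VP.lookup⇒[]= i p p[i])
    ... | false | true  = inj₂ (VP.lookup⇒[]= i q q[i])
    ... | false | false = ⊥-elim (differ refl)

    agree-on-selected : ∀ {j j′ i} → project j ≡ project j′ → i ∈ₗ ys → lookup (T j) i ≡ lookup (T j′) i
    agree-on-selected {j} {j′} {i} same i∈ys = begin
      lookup (T j) i                   ≡⟨ cong (lookup (T j)) (lookup-index i∈ys) ⟩
      lookup (T j) (L.lookup ys k)     ≡⟨ VP.lookup∘tabulate _ k ⟨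
      lookup (project j) k             ≡⟨ cong (λ v → lookup v k) same ⟩
      lookup (project j′) k            ≡⟨ VP.lookup∘tabulate _ k ⟩
      lookup (T j′) (L.lookup ys k)    ≡⟨ cong (lookup (T j′)) (lookup-index i∈ys) ⟨
      lookup (T j′) i                  ∎
      where
      open ≡-Reasoning
      k = Any.index i∈ys

    project-injective : ∀ {j j′} → j ∈ₗ ws ∖ᵂ S → j′ ∈ₗ ws ∖ᵂ S → project j ≡ project j′ → j ≡ j′
    project-injective {j} {j′} j∈ j′∈ same with j F.≟ j′
    ... | yes j≡j′ = j≡j′
    ... | no j≢j′ with sep j≢j′
    ...   | inj₁ Wj∈S = ⊥-elim (unselected j∈ Wj∈S)
    ...   | inj₂ (inj₁ Wj′∈S) = ⊥-elim (unselected j′∈ Wj′∈S)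
    ...   | inj₂ (inj₂ (i , Ui∈S , differ)) = ⊥-elim (differ (agree-on-selected same i∈ys))
      where
      ws⊆ : ∀ {j} → j ∈ₗ ws ∖ᵂ S → j ∈ₗ ws
      ws⊆ = proj₁ ∘ MP.∈-filter⁻ (λ j → ¬? (W j SP.∈? S)) {xs = ws}
      i∈cs : i ∈ₗ cs
      i∈cs with differ⇒∈ differ
      ... | inj₁ i∈Tj  = supported (ws⊆ j∈) i∈Tj
      ... | inj₂ i∈Tj′ = supported (ws⊆ j′∈) i∈Tj′
      i∈ys : i ∈ₗ ys
      i∈ys = MP.∈-filter⁺ (λ i → U i SP.∈? S) i∈cs Ui∈S

  module LowerBound (D : Decomposition r) (j₀ : Fin s) (T-j₀ : T j₀ ≡ ⊥)
    (onto : ∀ {B} → B ∈ₗ blocks D → ∀ {p} → p ∈ₗ patterns B → ∃ λ j → T j ≡ p) where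
    open import Data.List.Membership.DecPropositional (VP.≡-dec {n = r} BP._≟_) using () renaming (_∈?_ to _∈ₚ?_)

    members : PatternBlock r → List (Fin s)
    members B = filter (λ j → T j ∈ₚ? patterns B) (L.allFin s)

    ∈-members⁻ : ∀ {B j} → j ∈ₗ members B → T j ∈ₗ patterns B
    ∈-members⁻ {B} = proj₂ ∘ MP.∈-filter⁻ (λ j → T j ∈ₚ? patterns B) {xs = L.allFin s}

    members-unique : ∀ B → Unique (members B)
    members-unique B = UP.filter⁺ (λ j → T j ∈ₚ? patterns B) (UP.allFin⁺ s)

    members-supported : ∀ {B j} → j ∈ₗ members B → ∀ {i} → i ∈ T j → i ∈ₗ coords B
    members-supported {B} j∈ = patterns-supported B (∈-members⁻ {B} j∈)

    ∉T-j₀ : ∀ {i} → i ∉ T j₀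
    ∉T-j₀ {i} i∈ = SP.∉⊥ (subst (i ∈_) T-j₀ i∈)

    j₀∉members : ∀ {B} → j₀ ∉ₗ members B
    j₀∉members {B} j₀∈ = ∉T-j₀ (proj₂ (patterns-nonempty B (∈-members⁻ {B} j₀∈)))

    length-members : ∀ {B} → B ∈ₗ blocks D → length (patterns B) ≤ length (members B)
    length-members {B} B∈ = begin
      length (patterns B)          ≤⟨ length-≤-⊆ (patterns-unique B) labelled ⟩
      length (map T (members B))   ≡⟨ LP.length-map T (members B) ⟩
      length (members B)           ∎
      where
      open ≤-Reasoning
      labelled : ∀ {p} → p ∈ₗ patterns B → p ∈ₗ map T (members B)
      labelled p∈ with onto B∈ p∈
      ... | j , refl = MP.∈-map⁺ T (MP.∈-filter⁺ (λ j → T j ∈ₚ? patterns B) (MP.∈-allFin j) p∈)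

    selected : Subset (r + s) → PatternBlock r → List (Fin (r + s))
    selected S B = map U (S ∩ᵁ coords B) ++ map W (S ∩ᵂ members B)

    module _ {S : Subset (r + s)} (sep : Separating S) {B : PatternBlock r} (B∈ : B ∈ₗ blocks D) where
      private
        y = length (S ∩ᵁ coords B)

        length-selected : length (selected S B) ≡ y + length (S ∩ᵂ members B)
        length-selected = trans (LP.length-++ (map U (S ∩ᵁ coords B)))
          (cong₂ _+_ (LP.length-map U (S ∩ᵁ coords B)) (LP.length-map W (S ∩ᵂ members B)))

        partition : length (S ∩ᵂ members B) + length (members B ∖ᵂ S) ≡ length (members B)
        partition = length-filter+length-filter-¬ (λ j → W j SP.∈? S) (members B)

        y≤b : y ≤ length (coords B)
        y≤b = LP.length-filter (λ i → U i SP.∈? S) (coords B)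

      selected-≥ : length (coords B) ≤ length (selected S B)
      selected-≥ = begin
        length (coords B)                              ≤⟨ ample B y y≤b ⟩
        y + (length (patterns B) ∸ 2 ^ y)
          ≤⟨ +-monoʳ-≤ y (∸-≤-of-complement 0 partition (length-members B∈) unselected) ⟩
        y + length (S ∩ᵂ members B)                    ≡⟨ length-selected ⟨
        length (selected S B)                          ∎
        where
        open ≤-Reasoning
        unselected : length (members B ∖ᵂ S) ≤ 2 ^ y
        unselected = unselected-≤ sep (coords B) (members-unique B) (members-supported {B})

      selected-≥⁺ : W j₀ ∉ S → Any (λ i → U i ∉ S) (coords B) → length (coords B) < length (selected S B)
      selected-≥⁺ Wj₀∉S some-Ui∉S = begin
        suc (length (coords B))                        ≤⟨ ample⁺ B y y<b ⟩
        y + (suc (length (patterns B)) ∸ 2 ^ y)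
          ≤⟨ +-monoʳ-≤ y (∸-≤-of-complement 1 partition (length-members B∈) unselected-with-j₀) ⟩
        y + length (S ∩ᵂ members B)                    ≡⟨ length-selected ⟨
        length (selected S B)                          ∎
        where
        open ≤-Reasoning
        y<b : y < length (coords B)
        y<b = LP.filter-notAll (λ i → U i SP.∈? S) (coords B) some-Ui∉S
        unselected-with-j₀ : suc (length (members B ∖ᵂ S)) ≤ 2 ^ y
        unselected-with-j₀ =
          subst (_≤ 2 ^ y) (cong length (LP.filter-accept (λ j → ¬? (W j SP.∈? S)) {xs = members B} Wj₀∉S))
            (unselected-≤ sep (coords B) (AllP.¬Any⇒All¬ (members B) (j₀∉members {B}) ∷ members-unique B) supported)
          where
          supported : ∀ {j} → j ∈ₗ j₀ ∷ members B → ∀ {i} → i ∈ T j → i ∈ₗ coords B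
          supported (here refl) i∈Tj₀ = ⊥-elim (∉T-j₀ i∈Tj₀)
          supported (there j∈) = members-supported {B} j∈

    ∈-selected⁻ : ∀ {S B x} → x ∈ₗ selected S B →
      (∃ λ i → x ≡ U i × i ∈ₗ coords B × U i ∈ S) ⊎ (∃ λ j → x ≡ W j × j ∈ₗ members B × W j ∈ S)
    ∈-selected⁻ {S} {B} x∈ with MP.∈-++⁻ (map U (S ∩ᵁ coords B)) x∈
    ... | inj₁ x∈U with MP.∈-map⁻ U x∈U
    ...   | i , i∈ , refl = inj₁ (i , refl , MP.∈-filter⁻ (λ i → U i SP.∈? S) {xs = coords B} i∈)
    ∈-selected⁻ {S} {B} x∈ | inj₂ x∈W with MP.∈-map⁻ W x∈W
    ...   | j , j∈ , refl = inj₂ (j , refl , MP.∈-filter⁻ (λ j → W j SP.∈? S) {xs = members B} j∈)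

    selected-unique : ∀ S B → Unique (selected S B)
    selected-unique S B = UP.++⁺ (UP.map⁺ U-injective (UP.filter⁺ _ (coords-unique B)))
      (UP.map⁺ W-injective (UP.filter⁺ _ (members-unique B)))
      λ (x∈U , x∈W) → case MP.∈-map⁻ U x∈U , MP.∈-map⁻ W x∈W of λ where
        ((_ , _ , refl) , (_ , _ , Ui≡Wj)) → U≢W Ui≡Wj

    selected-disjoint : ∀ {S B B′} → Disjoint (coords B) (coords B′) → Disjoint (selected S B) (selected S B′)
    selected-disjoint {S} {B} {B′} disj (x∈ , x∈′) with ∈-selected⁻ {S} {B} x∈ | ∈-selected⁻ {S} {B′} x∈′
    ... | inj₁ (i , refl , i∈ , _) | inj₁ (i′ , Ui≡Ui′ , i′∈ , _) =
      disj (i∈ , subst (_∈ₗ coords B′) (sym (U-injective Ui≡Ui′)) i′∈)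
    ... | inj₁ (i , refl , _) | inj₂ (j , Ui≡Wj , _) = U≢W Ui≡Wj
    ... | inj₂ (j , refl , _) | inj₁ (i , Wj≡Ui , _) = U≢W (sym Wj≡Ui)
    ... | inj₂ (j , refl , j∈ , _) | inj₂ (j′ , Wj≡Wj′ , j′∈ , _) with patterns-nonempty B (∈-members⁻ {B} j∈)
    ...   | i , i∈Tj = disj (members-supported {B} j∈ i∈Tj ,
                             members-supported {B′} (subst (_∈ₗ members B′) (sym (W-injective Wj≡Wj′)) j′∈) i∈Tj)

    chosen : Subset (r + s) → List (Fin (r + s))
    chosen S = concatMap (selected S) (blocks D)

    chosen-unique : ∀ S → Unique (chosen S)
    chosen-unique S = UP.concat⁺ (AllP.map⁺ (All.tabulate (λ {B} _ → selected-unique S B)))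
      (AllPairsP.map⁺ (AllPairs.map (λ {B} {B′} → selected-disjoint {S} {B} {B′}) (disjoint D)))

    chosen⊆S : ∀ {S x} → x ∈ₗ chosen S → x ∈ S
    chosen⊆S {S} x∈ with ∈-concatMap⁻ (selected S) {blocks D} x∈
    ... | B , _ , x∈B with ∈-selected⁻ {S} {B} x∈B
    ...   | inj₁ (_ , refl , _ , Ui∈S) = Ui∈S
    ...   | inj₂ (_ , refl , _ , Wj∈S) = Wj∈S

    W-j₀∉chosen : ∀ {S} → W j₀ ∉ₗ chosen S
    W-j₀∉chosen {S} Wj₀∈ with ∈-concatMap⁻ (selected S) {blocks D} Wj₀∈
    ... | B , _ , Wj₀∈B with ∈-selected⁻ {S} {B} Wj₀∈B
    ...   | inj₁ (_ , Wj₀≡Ui , _) = U≢W (sym Wj₀≡Ui)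
    ...   | inj₂ (_ , Wj₀≡Wj , j∈ , _) = j₀∉members {B} (subst (_∈ₗ members B) (sym (W-injective Wj₀≡Wj)) j∈)

    r≤coords : r ≤ sum (map (length ∘ coords) (blocks D))
    r≤coords = begin
      r                                       ≡⟨ LP.length-tabulate {n = r} (λ i → i) ⟨
      length (L.allFin r)                     ≤⟨ length-≤-⊆ (UP.allFin⁺ r) (λ {i} _ → covered i) ⟩
      length (concatMap coords (blocks D))    ≡⟨ length-concatMap coords (blocks D) ⟩
      sum (map (length ∘ coords) (blocks D))  ∎
      where
      open ≤-Reasoning
      covered : ∀ i → i ∈ₗ concatMap coords (blocks D)
      covered i with find (covering D i)
      ... | B , B∈ , i∈ = ∈-concatMap⁺ coords B∈ i∈

    module _ {S : Subset (r + s)} (sep : Separating S) where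

      r≤length-chosen : r ≤ length (chosen S)
      r≤length-chosen = begin
        r                                           ≤⟨ r≤coords ⟩
        sum (map (length ∘ coords) (blocks D))      ≤⟨ sum-map-mono-≤ (All.tabulate (selected-≥ sep)) ⟩
        sum (map (length ∘ selected S) (blocks D))  ≡⟨ length-concatMap (selected S) (blocks D) ⟨
        length (chosen S)                           ∎
        where open ≤-Reasoning

      r<length-chosen : W j₀ ∉ S → ∀ {i} → U i ∉ S → r < length (chosen S)
      r<length-chosen Wj₀∉S {i} Ui∉S = begin-strict
        r                                           ≤⟨ r≤coords ⟩
        sum (map (length ∘ coords) (blocks D))      <⟨ sum-map-mono-< (All.tabulate (selected-≥ sep)) gain ⟩
        sum (map (length ∘ selected S) (blocks D))  ≡⟨ length-concatMap (selected S) (blocks D) ⟨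
        length (chosen S)                           ∎
        where
        open ≤-Reasoning
        gain : Any (λ B → length (coords B) < length (selected S B)) (blocks D)
        gain with find (covering D i)
        ... | B , B∈ , i∈ = lose B∈ (selected-≥⁺ sep B∈ Wj₀∉S (lose i∈ Ui∉S))

    length-chosen≤∣∣ : ∀ S → length (chosen S) ≤ ∣ S ∣
    length-chosen≤∣∣ S = length-≤-∣∣ (chosen-unique S) (All.tabulate chosen⊆S)

    separating⇒r≤∣∣ : ∀ {S} → Separating S → r ≤ ∣ S ∣
    separating⇒r≤∣∣ {S} sep = ≤-trans (r≤length-chosen sep) (length-chosen≤∣∣ S)

    W-j₀≁U : ∀ i → ¬ Adj H (W j₀) (U i)
    W-j₀≁U i Wj₀~Ui with trans (sym Wj₀~Ui) (trans (adjᶜ-WU j₀ i) (∉⇒lookup≡false ∉T-j₀))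
    ... | ()

    locating-dominatingᴴ⇒r<∣∣ : ∀ {S} → LocatingDominating H S → r < ∣ S ∣
    locating-dominatingᴴ⇒r<∣∣ {S} (dist , dom) with W j₀ SP.∈? S
    ... | yes Wj₀∈S = ≤-trans (s≤s (r≤length-chosen sep))
          (length-≤-∣∣ (AllP.¬Any⇒All¬ (chosen S) W-j₀∉chosen ∷ chosen-unique S) (Wj₀∈S ∷ All.tabulate chosen⊆S))
      where sep = distinguishing⇒separatingᴴ dist
    ... | no Wj₀∉S with FP.all? (λ i → U i SP.∈? S)
    ...   | no some-Ui∉S with FP.¬∀⟶∃¬ r _ (λ i → U i SP.∈? S) some-Ui∉S
    ...     | i , Ui∉S = <-≤-trans (r<length-chosen (distinguishing⇒separatingᴴ dist) Wj₀∉S Ui∉S) (length-chosen≤∣∣ S)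
    locating-dominatingᴴ⇒r<∣∣ {S} (dist , dom) | no Wj₀∉S | yes all-Ui∈S with dom (W j₀) Wj₀∉S
    ... | x , x∈S , Wj₀~x with side x
    ...   | inˡ i = ⊥-elim (W-j₀≁U i Wj₀~x)
    ...   | inʳ j = begin
      suc r                              ≡⟨ cong suc (trans (LP.length-map U (L.allFin r)) (LP.length-tabulate {n = r} (λ i → i))) ⟨
      length (W j ∷ map U (L.allFin r))  ≤⟨ length-≤-∣∣ (W-fresh ∷ UP.map⁺ U-injective (UP.allFin⁺ r)) (x∈S ∷ U⊆S) ⟩
      ∣ S ∣                              ∎
      where
      open ≤-Reasoning
      W-fresh : All (W j ≢_) (map U (L.allFin r))
      W-fresh = AllP.map⁺ (All.tabulate (λ _ → U≢W ∘ sym))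
      U⊆S : All (_∈ S) (map U (L.allFin r))
      U⊆S = AllP.map⁺ (All.tabulate (λ {i} _ → all-Ui∈S i))

module Witness (n s : ℕ) (3r+2≤2s : 3 * (3 + n) + 2 ≤ 2 * s) (s<2^r : s < 2 ^ (3 + n)) where

  private
    r = 3 + n
    D = decomposition (suc n)

  -- The empty pattern gives the vertex W j₀ that is adjacent in G to all of U.
  required : List (Subset r)
  required = ⊥ ∷ concatMap patterns (blocks D)

  required-proper : All Proper required
  required-proper = (zero , SP.∉⊥) ∷ All.tabulate λ p∈ →
    case ∈-concatMap⁻ patterns {blocks D} p∈ of λ (_ , B∈ , p∈B) → decomposition-proper n B∈ p∈B

  patternCount<s : patternCount D < s
  patternCount<s = *-cancelˡ-< 2 (patternCount D) s (begin-strict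
    2 * patternCount D   ≤⟨ patternCount-decomposition (suc n) ⟩
    3 * r + 1            <⟨ +-monoʳ-< (3 * r) (n<1+n 1) ⟩
    3 * r + 2            ≤⟨ 3r+2≤2s ⟩
    2 * s                ∎)
    where open ≤-Reasoning

  open Labelling (labelling required required-proper
    (subst (_≤ s) (cong suc (sym (length-concatMap patterns (blocks D)))) patternCount<s) s<2^r) public

  j₀ : Fin s
  j₀ = proj₁ (label-onto (here refl))

  label-j₀ : label j₀ ≡ ⊥
  label-j₀ = proj₂ (label-onto (here refl))

  open Construction label public
  open LowerBound D j₀ label-j₀ (λ B∈ p∈ → label-onto (there (∈-concatMap⁺ patterns B∈ p∈)))

  lambdaᴳ : IsLambda G r
  lambdaᴳ = (⊤ {r} ++ᵛ ⊥ {s} , U-locating-dominatingᴳ label-injective label-proper , ∣⊤++⊥∣ r s)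
      , λ S (dist , _) → separating⇒r≤∣∣ (distinguishing⇒separatingᴳ dist)

  lambdaᴴ : IsLambda H (r + 1)
  lambdaᴴ = (⊤ ++ᵛ ⁅ j₀ ⁆ , U+W-j₀-locating-dominatingᴴ label-injective j₀
            , trans (∣⊤++∣ r ⁅ j₀ ⁆) (cong (r +_) (SP.∣⁅x⁆∣≡1 j₀)))
      , λ S ld → subst (_≤ ∣ S ∣) (+-comm 1 r) (locating-dominatingᴴ⇒r<∣∣ ld)

proposition20 : ∀ (r s : ℕ) → 3 ≤ r → 3 * r + 2 ≤ 2 * s → s + 1 ≤ 2 ^ r →
    Σ (Graph (r + s)) λ G → Connected G × BipartiteWithParts G r s ×
      Σ ℕ λ k → IsLambda G k × IsLambda (complement G) (k + 1)
proposition20 (suc (suc (suc n))) s _ 3r+2≤2s s+1≤2^r =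
  G , connectedᴳ label-proper label-j₀ , bipartiteᴳ , 3 + n , lambdaᴳ , lambdaᴴ
  where open Witness n s 3r+2≤2s (subst (_≤ 2 ^ (3 + n)) (+-comm s 1) s+1≤2^r)
proposition20 (suc zero) s (s≤s ())
proposition20 (suc (suc zero)) s (s≤s (s≤s ()))
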